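{- Let $R$ be a finite non-local commutative ring with unity. Then the following are equivalent: (i) $G_{\mathrm{Id}}(R)$ is a split graph; (ii) $G_{\mathrm{Id}}(R)$ is a threshold graph; (iii) $R\cong \mathbb{Z}_2\times\mathbb{Z}_2\times\cdots\times\mathbb{Z}_2$ (a finite direct product of at least two copies of $\mathbb{Z}_2$).
   Context: For a ring $R$ with unity, an element $x\in R$ is idempotent if $x^2=x$; $\mathrm{Id}(R)$ denotes the set of idempotents of $R$. The idempotent graph $G_{\mathrm{Id}}(R)$ is the simple undirected graph with vertex set $R$ in which two distinct vertices $x,y$ are adjacent if and only if $x+y\in \mathrm{Id}(R)$. A ring is local if it has a unique maximal ideal; non-local otherwise. A split graph is a graph whose vertex set is the disjoint union of a clique and an independent set. A threshold graph is a graph with no induced subgraph isomorphic to $P_4$ (path on 4 vertices), $C_4$ (4-cycle) or $2K_2$ (two disjoint edges). -}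

module Defs where

open import Level using (Level; _⊔_; suc; 0ℓ)
open import Algebra.Bundles using (CommutativeRing; RawRing)
open import Algebra.Morphism.Structures using (module RingMorphisms)
open import Data.Bool using (Bool; true; false; _∧_; _xor_)
open import Data.Nat using (ℕ; _≤_)
open import Data.Fin using (Fin)
open import Data.Vec using (Vec; zipWith; replicate)
open import Data.Product using (Σ; _×_)
open import Relation.Nullary using (¬_)
open import Relation.Unary using (Pred; _⊆_)
open import Relation.Binary.Definitions using (_Respects_)
open import Relation.Binary.PropositionalEquality as ≡ using (_≡_)
open import Function.Bundles using (Inverse)

-- The ring ℤ₂ × ⋯ × ℤ₂ (k copies), as a raw ring on Vec Bool k:
-- ℤ₂ is represented by Bool with addition xor and multiplication ∧
-- (componentwise operations, negation is the identity in characteristic 2).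

Z₂^ : ℕ → RawRing 0ℓ 0ℓ
Z₂^ k = record
  { Carrier = Vec Bool k
  ; _≈_     = _≡_
  ; _+_     = zipWith _xor_
  ; _*_     = zipWith _∧_
  ; -_      = λ v → v
  ; 0#      = replicate k false
  ; 1#      = replicate k true
  }

module _ {c ℓ : Level} (R : CommutativeRing c ℓ) where
  open CommutativeRing R

  Finite : Set (c ⊔ ℓ)
  Finite = Σ ℕ λ n → Inverse setoid (≡.setoid (Fin n))

  record IsIdeal (I : Pred Carrier (c ⊔ ℓ)) : Set (c ⊔ ℓ) where
    field
      respects : I Respects _≈_
      has-0    : I 0#
      +-closed : ∀ {x y} → I x → I y → I (x + y)
      *-closed : ∀ r {x} → I x → I (r * x)

  IsMaximalIdeal : Pred Carrier (c ⊔ ℓ) → Set (suc (c ⊔ ℓ))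
  IsMaximalIdeal M =
    IsIdeal M × ¬ M 1# ×
    (∀ (J : Pred Carrier (c ⊔ ℓ)) → IsIdeal J → M ⊆ J → ¬ J 1# → J ⊆ M)

  IsLocal : Set (suc (c ⊔ ℓ))
  IsLocal = Σ (Pred Carrier (c ⊔ ℓ)) λ M →
    IsMaximalIdeal M ×
    (∀ N → IsMaximalIdeal N → (N ⊆ M) × (M ⊆ N))

  IsIdempotent : Carrier → Set ℓ
  IsIdempotent x = x * x ≈ x

  Adj : Carrier → Carrier → Set ℓ
  Adj x y = (x ≉ y) × IsIdempotent (x + y)

  Distinct4 : Carrier → Carrier → Carrier → Carrier → Set ℓ
  Distinct4 a b c d =
    (a ≉ b) × (a ≉ c) × (a ≉ d) × (b ≉ c) × (b ≉ d) × (c ≉ d)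

  InducedP4 : Carrier → Carrier → Carrier → Carrier → Set ℓ
  InducedP4 a b c d = Distinct4 a b c d ×
    Adj a b × Adj b c × Adj c d ×
    ¬ Adj a c × ¬ Adj b d × ¬ Adj a d

  InducedC4 : Carrier → Carrier → Carrier → Carrier → Set ℓ
  InducedC4 a b c d = Distinct4 a b c d ×
    Adj a b × Adj b c × Adj c d × Adj d a ×
    ¬ Adj a c × ¬ Adj b d

  Induced2K2 : Carrier → Carrier → Carrier → Carrier → Set ℓ
  Induced2K2 a b c d = Distinct4 a b c d ×
    Adj a b × Adj c d ×
    ¬ Adj a c × ¬ Adj a d × ¬ Adj b c × ¬ Adj b d

  IsThreshold : Set (c ⊔ ℓ)
  IsThreshold =
    (∀ a b c d → ¬ InducedP4 a b c d) ×
    (∀ a b c d → ¬ InducedC4 a b c d) ×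
    (∀ a b c d → ¬ Induced2K2 a b c d)

  IsSplit : Set (c ⊔ ℓ)
  IsSplit = Σ (Carrier → Bool) λ side →
    (∀ {x y} → x ≈ y → side x ≡ side y) ×
    (∀ x y → side x ≡ true → side y ≡ true → x ≉ y → Adj x y) ×
    (∀ x y → side x ≡ false → side y ≡ false → ¬ Adj x y)

  IsProductOfZ₂ : Set (c ⊔ ℓ)
  IsProductOfZ₂ = Σ ℕ λ k → (2 ≤ k) × Σ (Carrier → Vec Bool k) λ φ →
    RingMorphisms.IsRingIsomorphism rawRing (Z₂^ k) φ

-- A finite ring whose only idempotents are 0 and 1 is local: some power of each element is
-- idempotent, so the non-units are nilpotent and form the unique maximal ideal. A non-local R
-- therefore has an idempotent e ≠ 0, 1. If some x is not idempotent, then e x or (1 - e) x is not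
-- (say e x =: a), and the edges a — (1 - a) and 0 — (1 - e) form an induced 2K₂ of G_Id(R), which
-- neither a split nor a threshold graph contains. So (i) and (ii) both force R to be Boolean, and
-- in a Boolean ring every two distinct vertices are adjacent. Finally a finite Boolean ring is
-- ℤ₂ ^ k via its atoms p, sending x to the bits "p x = p", and k ≥ 2 because e ≠ 0, 1.
module Submission where

open import Defs
open import Algebra.Bundles using (CommutativeRing)
open import Data.Product using (_×_)
open import Relation.Nullary using (¬_)
open import Function.Bundles using (_⇔_)

open import Algebra.Morphism.Structures using (module RingMorphisms)
open import Data.Bool using (Bool; true; false; _∧_; _xor_)
open import Data.Bool.Properties using (∧-idem)
open import Data.Empty using (⊥-elim)
import Data.Fin.Properties as Fin
open import Data.Fin using (toℕ)
open import Data.List using (List; []; _∷_; foldr; length; filter; allFin)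
import Data.List as List
open import Data.List.Membership.Propositional.Properties using (∈-map⁺; ∈-allFin)
open import Data.List.Properties using (filter-accept; filter-reject)
open import Data.List.Relation.Unary.All as All using (All; []; _∷_)
import Data.List.Relation.Unary.All.Properties as All
open import Data.List.Relation.Unary.AllPairs using (AllPairs; []; _∷_)
import Data.List.Relation.Unary.AllPairs.Properties as AllPairs
open import Data.Nat using (ℕ; zero; suc; _≤_; s≤s)
import Data.Nat as ℕ
import Data.Nat.Properties as ℕ
open import Data.Product using (∃; _,_; proj₁; proj₂)
open import Data.Sum using (_⊎_; inj₁; inj₂)
open import Data.Vec using (Vec; []; _∷_; zipWith; replicate)
open import Data.Vec.Properties using (zipWith-idem)
open import Function.Base using (_∘_; case_of_)
open import Function.Bundles using (Inverse; mk⇔)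
open import Level using (Level; _⊔_)
open import Relation.Binary.Definitions using (Decidable)
open import Relation.Binary.PropositionalEquality as ≡ using (_≡_)
open import Relation.Nullary using (Dec; yes; no; ¬?)
open import Relation.Nullary.Decidable
  using (_×-dec_; map′; decidable-stable; does; dec-true; dec-false; does-⇔)
open import Relation.Unary using (Pred)

module Idempotents {c ℓ : Level} (R : CommutativeRing c ℓ) where
  open CommutativeRing R
  open import Algebra.Properties.Ring ring
    using (-0#≈0#; -‿involutive; +-cancelˡ; x∙y⁻¹≈ε⇒x≈y; x[y-z]≈xy-xz; [y-z]x≈yx-zx)
  open import Algebra.Properties.CommutativeSemigroup *-commutativeSemigroup
    using (interchange)
  open import Algebra.Properties.CommutativeSemiring.Exp commutativeSemiring
    using (_^_; ^-homo-*; ^-distrib-*) public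
  open import Algebra.Properties.CommutativeSemigroup ℕ.+-commutativeSemigroup
    using () renaming (x∙yz≈y∙xz to m+[n+o]≡n+[m+o])
  open import Relation.Binary.Reasoning.Setoid setoid

  Idempotent : Carrier → Set ℓ
  Idempotent = IsIdempotent R

  IsBoolean : Set (c ⊔ ℓ)
  IsBoolean = ∀ x → Idempotent x

  idempotent-resp : ∀ {x y} → x ≈ y → Idempotent x → Idempotent y
  idempotent-resp {x} {y} x≈y x²≈x = begin
    y * y ≈⟨ *-cong (sym x≈y) (sym x≈y) ⟩
    x * x ≈⟨ x²≈x ⟩
    x     ≈⟨ x≈y ⟩
    y     ∎

  ≈0⇒idempotent : ∀ {x} → x ≈ 0# → Idempotent x
  ≈0⇒idempotent x≈0 = idempotent-resp (sym x≈0) (zeroˡ 0#)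

  x-y≈x⇒y≈0 : ∀ x y → x - y ≈ x → y ≈ 0#
  x-y≈x⇒y≈0 x y x-y≈x = begin
    y       ≈⟨ sym (-‿involutive y) ⟩
    - - y   ≈⟨ -‿cong (+-cancelˡ x (- y) 0# (trans x-y≈x (sym (+-identityʳ x)))) ⟩
    - 0#    ≈⟨ -0#≈0# ⟩
    0#      ∎

  x+[1-x]≈1 : ∀ x → x + (1# - x) ≈ 1#
  x+[1-x]≈1 x = begin
    x + (1# - x)   ≈⟨ +-congˡ (+-comm 1# (- x)) ⟩
    x + (- x + 1#) ≈⟨ sym (+-assoc x (- x) 1#) ⟩
    (x - x) + 1#   ≈⟨ +-congʳ (-‿inverseʳ x) ⟩
    0# + 1#        ≈⟨ +-identityˡ 1# ⟩
    1#             ∎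

  idempotent⇒x*[1-x]≈0 : ∀ {e} → Idempotent e → e * (1# - e) ≈ 0#
  idempotent⇒x*[1-x]≈0 {e} e²≈e = begin
    e * (1# - e)        ≈⟨ x[y-z]≈xy-xz e 1# e ⟩
    e * 1# - e * e      ≈⟨ +-cong (*-identityʳ e) (-‿cong e²≈e) ⟩
    e - e               ≈⟨ -‿inverseʳ e ⟩
    0#                  ∎

  complement-idempotent : ∀ {e} → Idempotent e → Idempotent (1# - e)
  complement-idempotent {e} e²≈e = begin
    (1# - e) * (1# - e)            ≈⟨ [y-z]x≈yx-zx (1# - e) 1# e ⟩
    1# * (1# - e) - e * (1# - e)   ≈⟨ +-cong (*-identityˡ (1# - e)) (-‿cong (idempotent⇒x*[1-x]≈0 e²≈e)) ⟩
    (1# - e) - 0#                  ≈⟨ +-congˡ -0#≈0# ⟩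
    (1# - e) + 0#                  ≈⟨ +-identityʳ (1# - e) ⟩
    1# - e                         ∎

  *-idempotent : ∀ {u v} → Idempotent u → Idempotent v → Idempotent (u * v)
  *-idempotent {u} {v} u²≈u v²≈v = trans (interchange u v u v) (*-cong u²≈u v²≈v)

  +-idempotent : ∀ {u v} → Idempotent u → Idempotent v → u * v ≈ 0# → Idempotent (u + v)
  +-idempotent {u} {v} u²≈u v²≈v uv≈0 = begin
    (u + v) * (u + v)                   ≈⟨ distribʳ (u + v) u v ⟩
    u * (u + v) + v * (u + v)           ≈⟨ +-cong (distribˡ u u v) (distribˡ v u v) ⟩
    (u * u + u * v) + (v * u + v * v)   ≈⟨ +-cong (+-cong u²≈u uv≈0) (+-cong (trans (*-comm v u) uv≈0) v²≈v) ⟩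
    (u + 0#) + (0# + v)                 ≈⟨ +-cong (+-identityʳ u) (+-identityˡ v) ⟩
    u + v                               ∎

  idempotent-from-components : ∀ {e x} → Idempotent e →
    Idempotent (e * x) → Idempotent ((1# - e) * x) → Idempotent x
  idempotent-from-components {e} {x} e²≈e ex²≈ex fx²≈fx = idempotent-resp components-sum
    (+-idempotent ex²≈ex fx²≈fx (begin
      (e * x) * ((1# - e) * x) ≈⟨ interchange e x (1# - e) x ⟩
      (e * (1# - e)) * (x * x) ≈⟨ *-congʳ (idempotent⇒x*[1-x]≈0 e²≈e) ⟩
      0# * (x * x)             ≈⟨ zeroˡ (x * x) ⟩
      0#                       ∎))
    where
    components-sum : e * x + (1# - e) * x ≈ x
    components-sum = trans (sym (distribʳ x e (1# - e))) (trans (*-congʳ (x+[1-x]≈1 e)) (*-identityˡ x))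

  [e-a]²≈e-a⇒a²≈a : ∀ {e a} → Idempotent e → e * a ≈ a → Idempotent (e - a) → Idempotent a
  [e-a]²≈e-a⇒a²≈a {e} {a} e²≈e ea≈a [e-a]²≈e-a = sym (x∙y⁻¹≈ε⇒x≈y a (a * a)
    (x-y≈x⇒y≈0 (e - a) (a - a * a) (trans (sym [e-a]²) [e-a]²≈e-a)))
    where
    [e-a]² : (e - a) * (e - a) ≈ (e - a) - (a - a * a)
    [e-a]² = begin
      (e - a) * (e - a)             ≈⟨ [y-z]x≈yx-zx (e - a) e a ⟩
      e * (e - a) - a * (e - a)     ≈⟨ +-cong (x[y-z]≈xy-xz e e a) (-‿cong (x[y-z]≈xy-xz a e a)) ⟩
      (e * e - e * a) - (a * e - a * a)
        ≈⟨ +-cong (+-cong e²≈e (-‿cong ea≈a)) (-‿cong (+-congʳ (trans (*-comm a e) ea≈a))) ⟩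
      (e - a) - (a - a * a)         ∎

  NontrivialIdempotent : Carrier → Set ℓ
  NontrivialIdempotent e = Idempotent e × ¬ e ≈ 0# × ¬ e ≈ 1#

  nontrivialIdempotent-resp : ∀ {x y} → x ≈ y → NontrivialIdempotent x → NontrivialIdempotent y
  nontrivialIdempotent-resp x≈y (x²≈x , x≉0 , x≉1) =
    idempotent-resp x≈y x²≈x , (λ y≈0 → x≉0 (trans x≈y y≈0)) , (λ y≈1 → x≉1 (trans x≈y y≈1))

  ^-periodic : ∀ {x p i} → x ^ (p ℕ.+ i) ≈ x ^ i → ∀ k → x ^ (k ℕ.* p ℕ.+ i) ≈ x ^ i
  ^-periodic {x} {p} {i} xᵖ⁺ⁱ≈xⁱ zero = refl
  ^-periodic {x} {p} {i} xᵖ⁺ⁱ≈xⁱ (suc k) = begin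
    x ^ ((p ℕ.+ k ℕ.* p) ℕ.+ i)   ≡⟨ ≡.cong (x ^_) (ℕ.+-assoc p (k ℕ.* p) i) ⟩
    x ^ (p ℕ.+ (k ℕ.* p ℕ.+ i))   ≈⟨ ^-homo-* x p (k ℕ.* p ℕ.+ i) ⟩
    x ^ p * x ^ (k ℕ.* p ℕ.+ i)   ≈⟨ *-congˡ (^-periodic {x} {p} {i} xᵖ⁺ⁱ≈xⁱ k) ⟩
    x ^ p * x ^ i                 ≈⟨ sym (^-homo-* x p i) ⟩
    x ^ (p ℕ.+ i)                 ≈⟨ xᵖ⁺ⁱ≈xⁱ ⟩
    x ^ i                         ∎

  -- m is a multiple of the period 1 + p lying beyond the preperiod i, so x ^ (m + m) ≈ x ^ m.
  ^-periodic⇒idempotent : ∀ {x p i} → x ^ (suc p ℕ.+ i) ≈ x ^ i →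
    Idempotent (x ^ (suc i ℕ.* suc p))
  ^-periodic⇒idempotent {x} {p} {i} periodic
    with d , i+d≡m ← ℕ.m≤n⇒∃[o]m+o≡n (ℕ.≤-trans (ℕ.n≤1+n i) (ℕ.m≤m*n (suc i) (suc p))) = begin
    x ^ m * x ^ m              ≈⟨ sym (^-homo-* x m m) ⟩
    x ^ (m ℕ.+ m)              ≡⟨ ≡.cong (λ n → x ^ (m ℕ.+ n)) (≡.trans (≡.sym i+d≡m) (ℕ.+-comm i d)) ⟩
    x ^ (m ℕ.+ (d ℕ.+ i))      ≡⟨ ≡.cong (x ^_) (m+[n+o]≡n+[m+o] m d i) ⟩
    x ^ (d ℕ.+ (m ℕ.+ i))      ≈⟨ ^-homo-* x d (m ℕ.+ i) ⟩
    x ^ d * x ^ (m ℕ.+ i)      ≈⟨ *-congˡ (^-periodic {x} {suc p} {i} periodic (suc i)) ⟩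
    x ^ d * x ^ i              ≈⟨ sym (^-homo-* x d i) ⟩
    x ^ (d ℕ.+ i)              ≡⟨ ≡.cong (x ^_) (≡.trans (ℕ.+-comm d i) i+d≡m) ⟩
    x ^ m                      ∎
    where
    m : ℕ
    m = suc i ℕ.* suc p

module Units {c ℓ : Level} (R : CommutativeRing c ℓ) where
  open CommutativeRing R
  open Idempotents R
  open import Algebra.Properties.Ring ring using (-0#≈0#; x[y-z]≈xy-xz)
  open import Algebra.Properties.AbelianGroup +-abelianGroup using (xyx⁻¹≈y)
  open import Algebra.Properties.CommutativeSemigroup *-commutativeSemigroup using (x∙yz≈y∙xz)
  open import Relation.Binary.Reasoning.Setoid setoid

  IsUnit : Carrier → Set (c ⊔ ℓ)
  IsUnit x = ∃ λ u → x * u ≈ 1#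

  Nilpotent : Carrier → Set ℓ
  Nilpotent x = ∃ λ n → x ^ n ≈ 0#

  [x-y]+[y-z]≈x-z : ∀ x y z → (x - y) + (y - z) ≈ x - z
  [x-y]+[y-z]≈x-z x y z = begin
    (x - y) + (y - z)      ≈⟨ +-assoc x (- y) (y - z) ⟩
    x + (- y + (y - z))    ≈⟨ +-congˡ (sym (+-assoc (- y) y (- z))) ⟩
    x + ((- y + y) - z)    ≈⟨ +-congˡ (+-congʳ (-‿inverseˡ y)) ⟩
    x + (0# - z)           ≈⟨ +-congˡ (+-identityˡ (- z)) ⟩
    x - z                  ∎

  geometric : Carrier → ℕ → Carrier
  geometric z zero    = 0#
  geometric z (suc n) = 1# + z * geometric z n

  [1-z]*geometric≈1-zⁿ : ∀ z n → (1# - z) * geometric z n ≈ 1# - z ^ n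
  [1-z]*geometric≈1-zⁿ z zero = trans (zeroʳ (1# - z)) (sym (-‿inverseʳ 1#))
  [1-z]*geometric≈1-zⁿ z (suc n) = begin
    (1# - z) * (1# + z * g)                ≈⟨ distribˡ (1# - z) 1# (z * g) ⟩
    (1# - z) * 1# + (1# - z) * (z * g)     ≈⟨ +-cong (*-identityʳ (1# - z)) (x∙yz≈y∙xz (1# - z) z g) ⟩
    (1# - z) + z * ((1# - z) * g)          ≈⟨ +-congˡ (*-congˡ ([1-z]*geometric≈1-zⁿ z n)) ⟩
    (1# - z) + z * (1# - z ^ n)            ≈⟨ +-congˡ (trans (x[y-z]≈xy-xz z 1# (z ^ n)) (+-congʳ (*-identityʳ z))) ⟩
    (1# - z) + (z - z ^ suc n)             ≈⟨ [x-y]+[y-z]≈x-z 1# z (z ^ suc n) ⟩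
    1# - z ^ suc n                         ∎
    where
    g : Carrier
    g = geometric z n

  nilpotent⇒1-unit : ∀ {z} → Nilpotent z → IsUnit (1# - z)
  nilpotent⇒1-unit {z} (n , zⁿ≈0) = geometric z n , (begin
    (1# - z) * geometric z n   ≈⟨ [1-z]*geometric≈1-zⁿ z n ⟩
    1# - z ^ n                 ≈⟨ +-congˡ (trans (-‿cong zⁿ≈0) -0#≈0#) ⟩
    1# + 0#                    ≈⟨ +-identityʳ 1# ⟩
    1#                         ∎)

  nonunit+nilpotent : ∀ {x y} → ¬ IsUnit x → Nilpotent y → ¬ IsUnit (x + y)
  nonunit+nilpotent {x} {y} x-nonunit (n , yⁿ≈0) (u , [x+y]u≈1) = x-nonunit x-unit
    where
    yuⁿ≈0 : (y * u) ^ n ≈ 0#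
    yuⁿ≈0 = trans (^-distrib-* y u n) (trans (*-congʳ yⁿ≈0) (zeroˡ (u ^ n)))

    xu≈1-yu : x * u ≈ 1# - y * u
    xu≈1-yu = begin
      x * u                        ≈⟨ sym (xyx⁻¹≈y (y * u) (x * u)) ⟩
      (y * u + x * u) - y * u      ≈⟨ +-congʳ (trans (+-comm (y * u) (x * u)) (sym (distribʳ u x y))) ⟩
      (x + y) * u - y * u          ≈⟨ +-congʳ [x+y]u≈1 ⟩
      1# - y * u                   ∎

    x-unit : IsUnit x
    x-unit with v , [1-yu]v≈1 ← nilpotent⇒1-unit (n , yuⁿ≈0) = u * v , (begin
      x * (u * v)                ≈⟨ sym (*-assoc x u v) ⟩
      (x * u) * v                ≈⟨ *-congʳ xu≈1-yu ⟩
      (1# - y * u) * v           ≈⟨ [1-yu]v≈1 ⟩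
      1#                         ∎)

  nonunits-additive⇒local : ¬ 1# ≈ 0# →
    (∀ {x y} → ¬ IsUnit x → ¬ IsUnit y → ¬ IsUnit (x + y)) → IsLocal R
  nonunits-additive⇒local 1≉0 additive = M , (M-ideal , M-proper , M-maximal) , M-unique
    where
    M : Carrier → Set (c ⊔ ℓ)
    M x = ¬ IsUnit x

    M-ideal : IsIdeal R M
    M-ideal = record
      { respects = λ x≈y x-nonunit (u , yu≈1) → x-nonunit (u , trans (*-congʳ x≈y) yu≈1)
      ; has-0    = λ (u , 0u≈1) → 1≉0 (trans (sym 0u≈1) (zeroˡ u))
      ; +-closed = additive
      ; *-closed = λ r {x} x-nonunit (u , rxu≈1) →
          x-nonunit (r * u , trans (x∙yz≈y∙xz x r u) (trans (sym (*-assoc r x u)) rxu≈1))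
      }

    M-proper : ¬ M 1#
    M-proper 1-nonunit = 1-nonunit (1# , *-identityˡ 1#)

    proper⊆M : ∀ J → IsIdeal R J → ¬ J 1# → ∀ {x} → J x → M x
    proper⊆M J J-ideal 1∉J {x} x∈J (u , xu≈1) =
      1∉J (IsIdeal.respects J-ideal (trans (*-comm u x) xu≈1) (IsIdeal.*-closed J-ideal u x∈J))

    M-maximal : ∀ J → IsIdeal R J → (∀ {x} → M x → J x) → ¬ J 1# → ∀ {x} → J x → M x
    M-maximal J J-ideal _ = proper⊆M J J-ideal

    M-unique : ∀ N → IsMaximalIdeal R N → (∀ {x} → N x → M x) × (∀ {x} → M x → N x)
    M-unique N (N-ideal , 1∉N , N-maximal) =
      proper⊆M N N-ideal 1∉N , N-maximal M M-ideal (proper⊆M N N-ideal 1∉N) M-proper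

module FiniteRing {c ℓ : Level} (R : CommutativeRing c ℓ) (finite : Finite R) where
  open CommutativeRing R
  open Idempotents R
  open Units R
  open Inverse (proj₂ finite) using (to; from; to-cong; inverseʳ)
  open import Relation.Binary.Reasoning.Setoid setoid

  from∘to : ∀ x → from (to x) ≈ x
  from∘to x = inverseʳ ≡.refl

  to-injective : ∀ {x y} → to x ≡ to y → x ≈ y
  to-injective {x} {y} tox≡toy = trans (sym (from∘to x)) (inverseʳ tox≡toy)

  infix 4 _≈?_
  _≈?_ : Decidable _≈_
  x ≈? y = map′ to-injective to-cong (to x Fin.≟ to y)

  ∃? : ∀ {p} {P : Pred Carrier p} → (∀ x → Dec (P x)) → (∀ {x y} → x ≈ y → P x → P y) → Dec (∃ P)
  ∃? P? resp = map′ (λ (i , Pi) → from i , Pi) (λ (x , Px) → to x , resp (sym (from∘to x)) Px)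
    (Fin.any? (P? ∘ from))

  elements : List Carrier
  elements = List.map from (allFin (proj₁ finite))

  All-elements⇒∀ : ∀ {p} {P : Pred Carrier p} → (∀ {x y} → x ≈ y → P x → P y) →
    All P elements → ∀ x → P x
  All-elements⇒∀ resp all x = resp (from∘to x) (All.lookup all (∈-map⁺ from (∈-allFin (to x))))

  eventually-idempotent : ∀ x → ∃ λ n → Idempotent (x ^ suc n)
  eventually-idempotent x
    with i , j , i<j , same ← Fin.pigeonhole (ℕ.n<1+n (proj₁ finite)) (λ k → to (x ^ toℕ k))
    with p , 1+i+p≡j ← ℕ.m≤n⇒∃[o]m+o≡n i<j
    = p ℕ.+ toℕ i ℕ.* suc p , ^-periodic⇒idempotent {x} {p} {toℕ i} (sym (begin
      x ^ toℕ i                     ≈⟨ to-injective same ⟩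
      x ^ toℕ j                     ≡⟨ ≡.cong (x ^_) (≡.sym 1+i+p≡j) ⟩
      x ^ (suc (toℕ i ℕ.+ p))       ≡⟨ ≡.cong (λ n → x ^ suc n) (ℕ.+-comm (toℕ i) p) ⟩
      x ^ (suc p ℕ.+ toℕ i)         ∎))

  trivialIdempotents⇒local : ¬ 1# ≈ 0# → (∀ e → ¬ NontrivialIdempotent e) → IsLocal R
  trivialIdempotents⇒local 1≉0 trivial = nonunits-additive⇒local 1≉0
    λ x-nonunit y-nonunit → nonunit+nilpotent x-nonunit (nonunit⇒nilpotent y-nonunit)
    where
    nonunit⇒nilpotent : ∀ {y} → ¬ IsUnit y → Nilpotent y
    nonunit⇒nilpotent {y} y-nonunit with eventually-idempotent y
    ... | n , idempotent with y ^ suc n ≈? 0# | y ^ suc n ≈? 1#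
    ...   | yes yⁿ⁺¹≈0 | _          = suc n , yⁿ⁺¹≈0
    ...   | no _       | yes yⁿ⁺¹≈1 = ⊥-elim (y-nonunit (y ^ n , yⁿ⁺¹≈1))
    ...   | no yⁿ⁺¹≉0  | no yⁿ⁺¹≉1  = ⊥-elim (trivial (y ^ suc n) (idempotent , yⁿ⁺¹≉0 , yⁿ⁺¹≉1))

  nonlocal⇒nontrivialIdempotent : ¬ 1# ≈ 0# → ¬ IsLocal R → ∃ NontrivialIdempotent
  nonlocal⇒nontrivialIdempotent 1≉0 nonlocal
    with ∃? (λ e → (e * e ≈? e) ×-dec ¬? (e ≈? 0#) ×-dec ¬? (e ≈? 1#)) nontrivialIdempotent-resp
  ... | yes found = found
  ... | no none   = ⊥-elim (nonlocal (trivialIdempotents⇒local 1≉0 λ e nontrivial → none (e , nontrivial)))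

module IdempotentGraph {c ℓ : Level} (R : CommutativeRing c ℓ) where
  open CommutativeRing R
  open Idempotents R
  open import Algebra.Properties.Ring ring using (-0#≈0#; x∙y⁻¹≈ε⇒x≈y; x[y-z]≈xy-xz)
  open import Relation.Binary.Reasoning.Setoid setoid

  boolean⇒adjacent : IsBoolean → ∀ {x y} → ¬ x ≈ y → Adj R x y
  boolean⇒adjacent boolean {x} {y} x≉y = x≉y , boolean (x + y)

  boolean⇒split : IsBoolean → IsSplit R
  boolean⇒split boolean =
    (λ _ → true) , (λ _ → ≡.refl) , (λ _ _ _ _ → boolean⇒adjacent boolean) , λ _ _ ()

  boolean⇒threshold : IsBoolean → IsThreshold R
  boolean⇒threshold boolean =
      (λ { _ _ _ _ ((_ , a≉c , _) , _ , _ , _ , a≁c , _) → a≁c (adjacent a≉c) })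
    , (λ { _ _ _ _ ((_ , a≉c , _) , _ , _ , _ , _ , a≁c , _) → a≁c (adjacent a≉c) })
    , (λ { _ _ _ _ ((_ , a≉c , _) , _ , _ , a≁c , _) → a≁c (adjacent a≉c) })
    where
    adjacent : ∀ {x y} → ¬ x ≈ y → Adj R x y
    adjacent = boolean⇒adjacent boolean

  edge-meets-clique : ((side , _) : IsSplit R) → ∀ {x y} → Adj R x y →
    side x ≡ true ⊎ side y ≡ true
  edge-meets-clique (side , _ , _ , independent) {x} {y} x~y with side x in sx | side y in sy
  ... | true  | _     = inj₁ ≡.refl
  ... | false | true  = inj₂ ≡.refl
  ... | false | false = ⊥-elim (independent x y sx sy x~y)

  split⇒no-2K₂ : IsSplit R → ∀ a b c d → ¬ Induced2K2 R a b c d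
  split⇒no-2K₂ split@(_ , _ , clique , _) a b c d
    ((_ , a≉c , a≉d , b≉c , b≉d , _) , a~b , c~d , a≁c , a≁d , b≁c , b≁d)
    with edge-meets-clique split a~b | edge-meets-clique split c~d
  ... | inj₁ a∈K | inj₁ c∈K = a≁c (clique a c a∈K c∈K a≉c)
  ... | inj₁ a∈K | inj₂ d∈K = a≁d (clique a d a∈K d∈K a≉d)
  ... | inj₂ b∈K | inj₁ c∈K = b≁c (clique b c b∈K c∈K b≉c)
  ... | inj₂ b∈K | inj₂ d∈K = b≁d (clique b d b∈K d∈K b≉d)

  -- Multiplying by e sends each of the four cross sums to a or to e - a, neither of which
  -- is idempotent, while the edges are a + (1 - a) = 1 and 0 + (1 - e) = 1 - e.
  induced-2K₂ : ∀ {e x} → Idempotent e → ¬ e ≈ 1# → ¬ Idempotent (e * x) →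
    Induced2K2 R (e * x) (1# - e * x) 0# (1# - e)
  induced-2K₂ {e} {x} e²≈e e≉1 ¬idem-a =
    (a≉b , separated ea≈a ¬idem-a (zeroʳ e) , separated ea≈a ¬idem-a ef≈0 ,
      separated eb≈e-a ¬idem-e-a (zeroʳ e) , separated eb≈e-a ¬idem-e-a ef≈0 , 0≉f) ,
    (a≉b , idempotent-resp (sym (x+[1-x]≈1 a)) (*-identityˡ 1#)) ,
    (0≉f , idempotent-resp (sym (+-identityˡ f)) (complement-idempotent e²≈e)) ,
    (¬idem-via-e (trans (e[z+y]≈ez (zeroʳ e)) ea≈a) ¬idem-a ∘ proj₂) ,
    (¬idem-via-e (trans (e[z+y]≈ez ef≈0) ea≈a) ¬idem-a ∘ proj₂) ,
    (¬idem-via-e (trans (e[z+y]≈ez (zeroʳ e)) eb≈e-a) ¬idem-e-a ∘ proj₂) ,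
    (¬idem-via-e (trans (e[z+y]≈ez ef≈0) eb≈e-a) ¬idem-e-a ∘ proj₂)
    where
    a b f : Carrier
    a = e * x
    b = 1# - a
    f = 1# - e

    ea≈a : e * a ≈ a
    ea≈a = trans (sym (*-assoc e e x)) (*-congʳ e²≈e)

    eb≈e-a : e * b ≈ e - a
    eb≈e-a = trans (x[y-z]≈xy-xz e 1# a) (+-cong (*-identityʳ e) (-‿cong ea≈a))

    ef≈0 : e * f ≈ 0#
    ef≈0 = idempotent⇒x*[1-x]≈0 e²≈e

    fa≈0 : f * a ≈ 0#
    fa≈0 = trans (sym (*-assoc f e x)) (trans (*-congʳ (trans (*-comm f e) ef≈0)) (zeroˡ x))

    fb≈f : f * b ≈ f
    fb≈f = begin
      f * (1# - a)       ≈⟨ x[y-z]≈xy-xz f 1# a ⟩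
      f * 1# - f * a     ≈⟨ +-cong (*-identityʳ f) (trans (-‿cong fa≈0) -0#≈0#) ⟩
      f + 0#             ≈⟨ +-identityʳ f ⟩
      f                  ∎

    0≉f : ¬ 0# ≈ f
    0≉f 0≈f = e≉1 (sym (x∙y⁻¹≈ε⇒x≈y 1# e (sym 0≈f)))

    a≉b : ¬ a ≈ b
    a≉b a≈b = 0≉f (sym (trans (sym fb≈f) (trans (*-congˡ (sym a≈b)) fa≈0)))

    ¬idem-e-a : ¬ Idempotent (e - a)
    ¬idem-e-a = ¬idem-a ∘ [e-a]²≈e-a⇒a²≈a e²≈e ea≈a

    e[z+y]≈ez : ∀ {z y} → e * y ≈ 0# → e * (z + y) ≈ e * z
    e[z+y]≈ez {z} {y} ey≈0 = trans (distribˡ e z y) (trans (+-congˡ ey≈0) (+-identityʳ (e * z)))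

    ¬idem-via-e : ∀ {z w} → e * z ≈ w → ¬ Idempotent w → ¬ Idempotent z
    ¬idem-via-e ez≈w ¬idem-w z²≈z = ¬idem-w (idempotent-resp ez≈w (*-idempotent e²≈e z²≈z))

    separated : ∀ {z w y} → e * z ≈ w → ¬ Idempotent w → e * y ≈ 0# → ¬ z ≈ y
    separated ez≈w ¬idem-w ey≈0 z≈y =
      ¬idem-w (≈0⇒idempotent (trans (sym ez≈w) (trans (*-congˡ z≈y) ey≈0)))

  no-2K₂⇒boolean : Decidable _≈_ → ∃ NontrivialIdempotent →
    (∀ a b c d → ¬ Induced2K2 R a b c d) → IsBoolean
  no-2K₂⇒boolean _≈?_ (e , e²≈e , e≉0 , e≉1) no-2K₂ x =
    decidable-stable ((x * x) ≈? x) (refute (((e * x) * (e * x)) ≈? (e * x)))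
    where
    -- When e x is idempotent, (1 - e) x is not (their sum x is not), so use 1 - e instead.
    refute : Dec (Idempotent (e * x)) → ¬ ¬ Idempotent x
    refute (no ¬idem-ex)  _        = no-2K₂ _ _ _ _ (induced-2K₂ e²≈e e≉1 ¬idem-ex)
    refute (yes ex²≈ex)   ¬idem-x  = no-2K₂ _ _ _ _ (induced-2K₂ (complement-idempotent e²≈e) 1-e≉1
      λ fx²≈fx → ¬idem-x (idempotent-from-components e²≈e ex²≈ex fx²≈fx))
      where
      1-e≉1 : ¬ 1# - e ≈ 1#
      1-e≉1 1-e≈1 = e≉0 (x-y≈x⇒y≈0 1# e 1-e≈1)

module BooleanRing {c ℓ : Level} (R : CommutativeRing c ℓ)
                   (boolean : Idempotents.IsBoolean R) where
  open CommutativeRing R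
  open Idempotents R
  open import Algebra.Properties.Ring ring using (+-cancelˡ; +-inverseʳ-unique)
  open import Algebra.Properties.CommutativeSemigroup *-commutativeSemigroup
    using (interchange; xy∙z≈xz∙y)
  open import Relation.Binary.Reasoning.Setoid setoid

  x+x≈0 : ∀ x → x + x ≈ 0#
  x+x≈0 x = +-cancelˡ (x + x) (x + x) 0# (begin
    (x + x) + (x + x)                   ≈⟨ sym (+-cong (+-cong (boolean x) (boolean x)) (+-cong (boolean x) (boolean x))) ⟩
    (x * x + x * x) + (x * x + x * x)   ≈⟨ sym (+-cong (distribʳ x x x) (distribʳ x x x)) ⟩
    (x + x) * x + (x + x) * x           ≈⟨ sym (distribˡ (x + x) x x) ⟩
    (x + x) * (x + x)                   ≈⟨ boolean (x + x) ⟩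
    x + x                               ≈⟨ sym (+-identityʳ (x + x)) ⟩
    (x + x) + 0#                        ∎)

  -x≈x : ∀ x → - x ≈ x
  -x≈x x = sym (+-inverseʳ-unique x x (x+x≈0 x))

  Orthogonal : Carrier → Carrier → Set ℓ
  Orthogonal p q = p * q ≈ 0#

  -- In Boolean-algebra terms: p ≤ ¬ x or p ≤ x.
  Homogeneous : Carrier → Carrier → Set ℓ
  Homogeneous p x = p * x ≈ 0# ⊎ p * x ≈ p

  homogeneous-resp : ∀ {p x y} → x ≈ y → Homogeneous p x → Homogeneous p y
  homogeneous-resp x≈y (inj₁ px≈0) = inj₁ (trans (*-congˡ (sym x≈y)) px≈0)
  homogeneous-resp x≈y (inj₂ px≈p) = inj₂ (trans (*-congˡ (sym x≈y)) px≈p)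

  homogeneous-* : ∀ {p x} w → Homogeneous p x → Homogeneous (p * w) x
  homogeneous-* {p} {x} w (inj₁ px≈0) = inj₁ (trans (xy∙z≈xz∙y p w x) (trans (*-congʳ px≈0) (zeroˡ w)))
  homogeneous-* {p} {x} w (inj₂ px≈p) = inj₂ (trans (xy∙z≈xz∙y p w x) (*-congʳ px≈p))

  homogeneous-[p*u]-u : ∀ {p u} → Homogeneous (p * u) u
  homogeneous-[p*u]-u {p} {u} = inj₂ (trans (*-assoc p u u) (*-congˡ (boolean u)))

  homogeneous-[p*[1-u]]-u : ∀ {p u} → Homogeneous (p * (1# - u)) u
  homogeneous-[p*[1-u]]-u {p} {u} = inj₁ (begin
    (p * (1# - u)) * u   ≈⟨ *-assoc p (1# - u) u ⟩
    p * ((1# - u) * u)   ≈⟨ *-congˡ (trans (*-comm (1# - u) u) (idempotent⇒x*[1-x]≈0 (boolean u))) ⟩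
    p * 0#               ≈⟨ zeroʳ p ⟩
    0#                   ∎)

  orthogonal-* : ∀ {p q} v w → Orthogonal p q → Orthogonal (p * v) (q * w)
  orthogonal-* {p} {q} v w pq≈0 = trans (interchange p v q w) (trans (*-congʳ pq≈0) (zeroˡ (v * w)))

  sum : List Carrier → Carrier
  sum = foldr _+_ 0#

  refine : Carrier → List Carrier → List Carrier
  refine u []       = []
  refine u (p ∷ ps) = p * u ∷ p * (1# - u) ∷ refine u ps

  refine⁺ : ∀ {p₁ p₂} {P : Carrier → Set p₁} {Q : Carrier → Set p₂} {u ps} →
    (∀ {p} → P p → Q (p * u)) → (∀ {p} → P p → Q (p * (1# - u))) → All P ps → All Q (refine u ps)
  refine⁺ on-u on-1-u []         = []
  refine⁺ on-u on-1-u (Pp ∷ Pps) = on-u Pp ∷ on-1-u Pp ∷ refine⁺ on-u on-1-u Pps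

  refine-sum : ∀ u ps → sum (refine u ps) ≈ sum ps
  refine-sum u []       = refl
  refine-sum u (p ∷ ps) = begin
    p * u + (p * (1# - u) + sum (refine u ps))   ≈⟨ sym (+-assoc (p * u) (p * (1# - u)) _) ⟩
    (p * u + p * (1# - u)) + sum (refine u ps)   ≈⟨ +-cong (sym (distribˡ p u (1# - u))) (refine-sum u ps) ⟩
    p * (u + (1# - u)) + sum ps                  ≈⟨ +-congʳ (trans (*-congˡ (x+[1-x]≈1 u)) (*-identityʳ p)) ⟩
    p + sum ps                                   ∎

  refine-orthogonal : ∀ u {ps} → AllPairs Orthogonal ps → AllPairs Orthogonal (refine u ps)
  refine-orthogonal u []               = []
  refine-orthogonal u {p ∷ _} (p⊥ps ∷ ps-orth) =
    (pu⊥p[1-u] ∷ refine⁺ (orthogonal-* u u) (orthogonal-* u (1# - u)) p⊥ps) ∷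
    refine⁺ (orthogonal-* (1# - u) u) (orthogonal-* (1# - u) (1# - u)) p⊥ps ∷
    refine-orthogonal u ps-orth
    where
    pu⊥p[1-u] : Orthogonal (p * u) (p * (1# - u))
    pu⊥p[1-u] = trans (interchange p u p (1# - u))
      (trans (*-congˡ (idempotent⇒x*[1-x]≈0 (boolean u))) (zeroʳ (p * p)))

  -- The nonzero pieces of us are the atoms of the Boolean subring generated by us.
  pieces : List Carrier → List Carrier
  pieces = foldr refine (1# ∷ [])

  pieces-sum : ∀ us → sum (pieces us) ≈ 1#
  pieces-sum []       = +-identityʳ 1#
  pieces-sum (u ∷ us) = trans (refine-sum u (pieces us)) (pieces-sum us)

  pieces-orthogonal : ∀ us → AllPairs Orthogonal (pieces us)
  pieces-orthogonal []       = [] ∷ []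
  pieces-orthogonal (u ∷ us) = refine-orthogonal u (pieces-orthogonal us)

  pieces-homogeneous : ∀ us → All (λ p → All (Homogeneous p) us) (pieces us)
  pieces-homogeneous []       = [] ∷ []
  pieces-homogeneous (u ∷ us) = refine⁺
    (λ p-hom → homogeneous-[p*u]-u ∷ All.map (homogeneous-* u) p-hom)
    (λ p-hom → homogeneous-[p*[1-u]]-u ∷ All.map (homogeneous-* (1# - u)) p-hom)
    (pieces-homogeneous us)

module Coordinates {c ℓ : Level} (R : CommutativeRing c ℓ)
                   (boolean : Idempotents.IsBoolean R)
                   (_≈?_ : Decidable (CommutativeRing._≈_ R)) where
  open CommutativeRing R
  open Idempotents R
  open BooleanRing R boolean
  open import Algebra.Properties.CommutativeSemigroup *-commutativeSemigroup using (interchange)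
  open import Relation.Binary.Reasoning.Setoid setoid

  IsAtom : Carrier → Set (c ⊔ ℓ)
  IsAtom p = ¬ p ≈ 0# × ∀ x → Homogeneous p x

  coord : Carrier → Carrier → Bool
  coord x p = does ((p * x) ≈? p)

  infixr 7 _•_
  _•_ : Bool → Carrier → Carrier
  true  • p = p
  false • p = 0#

  •-xor : ∀ a b p → a • p + b • p ≈ (a xor b) • p
  •-xor true  true  p = x+x≈0 p
  •-xor true  false p = +-identityʳ p
  •-xor false true  p = +-identityˡ p
  •-xor false false p = +-identityˡ 0#

  •-∧ : ∀ a b p → Idempotent p → (a • p) * (b • p) ≈ (a ∧ b) • p
  •-∧ true  true  p p²≈p = p²≈p
  •-∧ true  false p _   = zeroʳ p
  •-∧ false b     p _   = zeroˡ (b • p)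

  •-orthogonal : ∀ b {q p} → q * p ≈ 0# → q * (b • p) ≈ 0#
  •-orthogonal true  qp≈0 = qp≈0
  •-orthogonal false _    = zeroʳ _

  coord-resp : ∀ {p x y} → p * x ≈ p * y → coord x p ≡ coord y p
  coord-resp {p} {x} {y} px≈py =
    does-⇔ (mk⇔ (trans (sym px≈py)) (trans px≈py)) ((p * x) ≈? p) ((p * y) ≈? p)

  coord-spec : ∀ {p x} → Homogeneous p x → p * x ≈ coord x p • p
  coord-spec {p} {x} hom with (p * x) ≈? p
  ... | yes px≈p = px≈p
  ... | no px≉p with hom
  ...   | inj₁ px≈0 = px≈0
  ...   | inj₂ px≈p = ⊥-elim (px≉p px≈p)

  coord-unique : ∀ {p x} b → ¬ p ≈ 0# → p * x ≈ b • p → coord x p ≡ b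
  coord-unique {p} {x} true  _   px≈p = dec-true ((p * x) ≈? p) px≈p
  coord-unique {p} {x} false p≉0 px≈0 = dec-false ((p * x) ≈? p) λ px≈p → p≉0 (trans (sym px≈p) px≈0)

  coord-+ : ∀ {p} → IsAtom p → ∀ x y → coord (x + y) p ≡ coord x p xor coord y p
  coord-+ {p} (p≉0 , hom) x y = coord-unique _ p≉0 (begin
    p * (x + y)                    ≈⟨ distribˡ p x y ⟩
    p * x + p * y                  ≈⟨ +-cong (coord-spec (hom x)) (coord-spec (hom y)) ⟩
    coord x p • p + coord y p • p  ≈⟨ •-xor (coord x p) (coord y p) p ⟩
    (coord x p xor coord y p) • p  ∎)

  coord-* : ∀ {p} → IsAtom p → ∀ x y → coord (x * y) p ≡ coord x p ∧ coord y p
  coord-* {p} (p≉0 , hom) x y = coord-unique _ p≉0 (begin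
    p * (x * y)                      ≈⟨ *-congʳ (sym (boolean p)) ⟩
    (p * p) * (x * y)                ≈⟨ interchange p p x y ⟩
    (p * x) * (p * y)                ≈⟨ *-cong (coord-spec (hom x)) (coord-spec (hom y)) ⟩
    (coord x p • p) * (coord y p • p) ≈⟨ •-∧ (coord x p) (coord y p) p (boolean p) ⟩
    (coord x p ∧ coord y p) • p      ∎)

  coords : (ps : List Carrier) → Carrier → Vec Bool (length ps)
  coords []       x = []
  coords (p ∷ ps) x = coord x p ∷ coords ps x

  coords-cong : ∀ {ps x y} → All (λ p → p * x ≈ p * y) ps → coords ps x ≡ coords ps y
  coords-cong []           = ≡.refl
  coords-cong (px≈py ∷ eq) = ≡.cong₂ _∷_ (coord-resp px≈py) (coords-cong eq)

  coords-resp : ∀ {ps x y} → x ≈ y → coords ps x ≡ coords ps y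
  coords-resp {ps} x≈y = coords-cong (All.universal (λ p → *-congˡ x≈y) ps)

  coords-zipWith : ∀ {ps x y z} (f : Bool → Bool → Bool) →
    All (λ p → coord z p ≡ f (coord x p) (coord y p)) ps →
    coords ps z ≡ zipWith f (coords ps x) (coords ps y)
  coords-zipWith f []         = ≡.refl
  coords-zipWith f (eq ∷ eqs) = ≡.cong₂ _∷_ eq (coords-zipWith f eqs)

  coords-replicate : ∀ {ps x b} → All (λ p → coord x p ≡ b) ps →
    coords ps x ≡ replicate (length ps) b
  coords-replicate []         = ≡.refl
  coords-replicate (eq ∷ eqs) = ≡.cong₂ _∷_ eq (coords-replicate eqs)

  combine : (ps : List Carrier) → Vec Bool (length ps) → Carrier
  combine []       []       = 0#
  combine (p ∷ ps) (b ∷ bs) = b • p + combine ps bs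

  x*sum≈combine-coords : ∀ {ps x} → All (λ p → Homogeneous p x) ps →
    x * sum ps ≈ combine ps (coords ps x)
  x*sum≈combine-coords {[]}     {x} []           = zeroʳ x
  x*sum≈combine-coords {p ∷ ps} {x} (hom ∷ homs) = begin
    x * (p + sum ps)                           ≈⟨ distribˡ x p (sum ps) ⟩
    x * p + x * sum ps                         ≈⟨ +-cong (trans (*-comm x p) (coord-spec hom)) (x*sum≈combine-coords homs) ⟩
    coord x p • p + combine ps (coords ps x)   ∎

  combine-orthogonal : ∀ {q ps} → All (Orthogonal q) ps → ∀ bs → q * combine ps bs ≈ 0#
  combine-orthogonal {q} []             []       = zeroʳ q
  combine-orthogonal {q} (qp≈0 ∷ q⊥ps) (b ∷ bs) =
    trans (distribˡ q _ _) (trans (+-cong (•-orthogonal b qp≈0) (combine-orthogonal q⊥ps bs)) (+-identityˡ 0#))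

  coords-combine : ∀ {ps} → All (λ p → ¬ p ≈ 0#) ps → AllPairs Orthogonal ps →
    ∀ bs → coords ps (combine ps bs) ≡ bs
  coords-combine {[]}     []           []               []       = ≡.refl
  coords-combine {p ∷ ps} (p≉0 ∷ ps≉0) (p⊥ps ∷ ps-orth) (b ∷ bs) = ≡.cong₂ _∷_
    (coord-unique b p≉0 (begin
      p * (b • p + combine ps bs)        ≈⟨ distribˡ p (b • p) (combine ps bs) ⟩
      p * (b • p) + p * combine ps bs    ≈⟨ +-cong (p*[b•p]≈b•p b) (combine-orthogonal p⊥ps bs) ⟩
      b • p + 0#                         ≈⟨ +-identityʳ (b • p) ⟩
      b • p                              ∎))
    (≡.trans (coords-cong (All.map q[b•p+y]≈qy p⊥ps)) (coords-combine ps≉0 ps-orth bs))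
    where
    p*[b•p]≈b•p : ∀ b → p * (b • p) ≈ b • p
    p*[b•p]≈b•p true  = boolean p
    p*[b•p]≈b•p false = zeroʳ p

    q[b•p+y]≈qy : ∀ {q} → Orthogonal p q → q * (b • p + combine ps bs) ≈ q * combine ps bs
    q[b•p+y]≈qy {q} pq≈0 = trans (distribˡ q _ _)
      (trans (+-congʳ (•-orthogonal b (trans (*-comm q p) pq≈0))) (+-identityˡ _))

  module _ {ps} (atoms : All IsAtom ps) (orthogonal : AllPairs Orthogonal ps) (sum≈1 : sum ps ≈ 1#) where
    open RingMorphisms rawRing (Z₂^ (length ps))

    x≈combine-coords : ∀ x → x ≈ combine ps (coords ps x)
    x≈combine-coords x = begin
      x                          ≈⟨ sym (*-identityʳ x) ⟩
      x * 1#                     ≈⟨ *-congˡ (sym sum≈1) ⟩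
      x * sum ps                 ≈⟨ x*sum≈combine-coords (All.map (λ (_ , hom) → hom x) atoms) ⟩
      combine ps (coords ps x)   ∎

    coords-injective : ∀ {x y} → coords ps x ≡ coords ps y → x ≈ y
    coords-injective {x} {y} eq = begin
      x                          ≈⟨ x≈combine-coords x ⟩
      combine ps (coords ps x)   ≡⟨ ≡.cong (combine ps) eq ⟩
      combine ps (coords ps y)   ≈⟨ sym (x≈combine-coords y) ⟩
      y                          ∎

    coords-isRingIsomorphism : IsRingIsomorphism (coords ps)
    coords-isRingIsomorphism = record
      { isRingMonomorphism = record
        { isRingHomomorphism = record
          { isSemiringHomomorphism = record
            { isNearSemiringHomomorphism = record
              { +-isMonoidHomomorphism = record
                { isMagmaHomomorphism = record
                  { isRelHomomorphism = record { cong = coords-resp }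
                  ; homo = λ x y → coords-zipWith _xor_ (All.map (λ atom → coord-+ atom x y) atoms)
                  }
                ; ε-homo = coords-replicate (All.map (λ (p≉0 , _) → coord-unique false p≉0 (zeroʳ _)) atoms)
                }
              ; *-homo = λ x y → coords-zipWith _∧_ (All.map (λ atom → coord-* atom x y) atoms)
              }
            ; 1#-homo = coords-replicate (All.map (λ (p≉0 , _) → coord-unique true p≉0 (*-identityʳ _)) atoms)
            }
          ; -‿homo = λ x → coords-resp (-x≈x x)
          }
        ; injective = coords-injective
        }
      ; surjective = λ bs → combine ps bs , λ z≈combine →
          ≡.trans (coords-resp z≈combine) (coords-combine (All.map proj₁ atoms) orthogonal bs)
      }

module ProductOfZ₂ {c ℓ : Level} (R : CommutativeRing c ℓ) where
  open CommutativeRing R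
  open Idempotents R

  short-vector-constant : ∀ {k} (v : Vec Bool k) → k ≤ 1 →
    v ≡ replicate k false ⊎ v ≡ replicate k true
  short-vector-constant []           _ = inj₁ ≡.refl
  short-vector-constant (false ∷ []) _ = inj₁ ≡.refl
  short-vector-constant (true ∷ [])  _ = inj₂ ≡.refl
  short-vector-constant (_ ∷ _ ∷ _)  (s≤s ())

  module _ {k} {φ : Carrier → Vec Bool k} (mono : RingMorphisms.IsRingMonomorphism rawRing (Z₂^ k) φ) where
    open RingMorphisms.IsRingMonomorphism mono using (injective; *-homo; 0#-homo; 1#-homo)

    monomorphism⇒boolean : IsBoolean
    monomorphism⇒boolean x = injective (≡.trans (*-homo x x) (zipWith-idem ∧-idem (φ x)))

    monomorphism⇒2≤k : ∃ NontrivialIdempotent → 2 ≤ k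
    monomorphism⇒2≤k (e , _ , e≉0 , e≉1) = ℕ.≰⇒> λ k≤1 →
      case short-vector-constant (φ e) k≤1 of λ where
        (inj₁ φe≡0) → e≉0 (injective (≡.trans φe≡0 (≡.sym 0#-homo)))
        (inj₂ φe≡1) → e≉1 (injective (≡.trans φe≡1 (≡.sym 1#-homo)))

module FiniteBooleanRing {c ℓ : Level} (R : CommutativeRing c ℓ) (finite : Finite R)
                         (boolean : Idempotents.IsBoolean R) where
  open CommutativeRing R
  open FiniteRing R finite using (_≈?_; elements; All-elements⇒∀)
  open BooleanRing R boolean
  open Coordinates R boolean _≈?_
  open Idempotents R using (NontrivialIdempotent)
  open ProductOfZ₂ R using (monomorphism⇒2≤k)
  open import Relation.Binary.Reasoning.Setoid setoid

  nonzero? : ∀ p → Dec (¬ p ≈ 0#)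
  nonzero? p = ¬? (p ≈? 0#)

  atoms : List Carrier
  atoms = filter nonzero? (pieces elements)

  sum-filter-nonzero : ∀ ps → sum (filter nonzero? ps) ≈ sum ps
  sum-filter-nonzero []       = refl
  sum-filter-nonzero (p ∷ ps) with p ≈? 0#
  ... | yes p≈0 = begin
    sum (filter nonzero? (p ∷ ps))   ≡⟨ ≡.cong sum (filter-reject nonzero? (λ p≉0 → p≉0 p≈0)) ⟩
    sum (filter nonzero? ps)         ≈⟨ sum-filter-nonzero ps ⟩
    sum ps                           ≈⟨ sym (+-identityˡ (sum ps)) ⟩
    0# + sum ps                      ≈⟨ +-congʳ (sym p≈0) ⟩
    p + sum ps                       ∎
  ... | no p≉0 = begin
    sum (filter nonzero? (p ∷ ps))   ≡⟨ ≡.cong sum (filter-accept nonzero? p≉0) ⟩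
    p + sum (filter nonzero? ps)     ≈⟨ +-congˡ (sum-filter-nonzero ps) ⟩
    p + sum ps                       ∎

  atoms-areAtoms : All IsAtom atoms
  atoms-areAtoms = All.zip (All.all-filter nonzero? (pieces elements) ,
    All.filter⁺ nonzero? (All.map (All-elements⇒∀ homogeneous-resp) (pieces-homogeneous elements)))

  atoms-orthogonal : AllPairs Orthogonal atoms
  atoms-orthogonal = AllPairs.filter⁺ nonzero? (pieces-orthogonal elements)

  atoms-sum : sum atoms ≈ 1#
  atoms-sum = trans (sum-filter-nonzero (pieces elements)) (pieces-sum elements)

  boolean⇒productOfZ₂ : ∃ NontrivialIdempotent → IsProductOfZ₂ R
  boolean⇒productOfZ₂ nontrivial = length atoms ,
    monomorphism⇒2≤k (RingMorphisms.IsRingIsomorphism.isRingMonomorphism iso) nontrivial ,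
    coords atoms , iso
    where
    iso : RingMorphisms.IsRingIsomorphism rawRing (Z₂^ (length atoms)) (coords atoms)
    iso = coords-isRingIsomorphism atoms-areAtoms atoms-orthogonal atoms-sum

corollary4p2 : ∀ {c ℓ} (R : CommutativeRing c ℓ) →
    Finite R →
    ¬ CommutativeRing._≈_ R (CommutativeRing.1# R) (CommutativeRing.0# R) →
    ¬ IsLocal R →
    (IsSplit R ⇔ IsThreshold R) × (IsThreshold R ⇔ IsProductOfZ₂ R)
corollary4p2 R finite 1≉0 nonlocal =
  mk⇔ (boolean⇒threshold ∘ split⇒boolean) (boolean⇒split ∘ threshold⇒boolean) ,
  mk⇔ (boolean⇒productOfZ₂ ∘ threshold⇒boolean) (boolean⇒threshold ∘ product⇒boolean)
  where
  open Idempotents R using (IsBoolean; NontrivialIdempotent)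
  open FiniteRing R finite using (_≈?_; nonlocal⇒nontrivialIdempotent)
  open IdempotentGraph R using (boolean⇒split; boolean⇒threshold; split⇒no-2K₂; no-2K₂⇒boolean)

  nontrivial : ∃ NontrivialIdempotent
  nontrivial = nonlocal⇒nontrivialIdempotent 1≉0 nonlocal

  split⇒boolean : IsSplit R → IsBoolean
  split⇒boolean split = no-2K₂⇒boolean _≈?_ nontrivial (split⇒no-2K₂ split)

  threshold⇒boolean : IsThreshold R → IsBoolean
  threshold⇒boolean (_ , _ , no-2K₂) = no-2K₂⇒boolean _≈?_ nontrivial no-2K₂

  product⇒boolean : IsProductOfZ₂ R → IsBoolean
  product⇒boolean (_ , _ , _ , iso) = ProductOfZ₂.monomorphism⇒boolean R
    (RingMorphisms.IsRingIsomorphism.isRingMonomorphism iso)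

  boolean⇒productOfZ₂ : IsBoolean → IsProductOfZ₂ R
  boolean⇒productOfZ₂ boolean = FiniteBooleanRing.boolean⇒productOfZ₂ R finite boolean nontrivial
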